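{- Let $D$ be a defeasible theory and $S_D$ its compiled program. Then $S_D$ is: (1) a Datalog$^\neg$ program iff $D$ is function-free; (2) variable-free iff $D$ is variable-free; (3) range-restricted iff $D$ is range-restricted; (4) safe iff $D$ is range-restricted; (5) call-consistent; (6) stratified if $D$ is hierarchical; (7) locally stratified if $D$ is locally hierarchical.
   Context: Defeasible theories. Terms are built from variables, constants and function symbols. A literal is an atom $p(t_1,\dots,t_n)$ or its classical negation; ${\sim}q$ is the complementary literal. A defeasible theory $D=(F,R,>)$ consists of a finite set $F$ of literals (facts), a finite set $R$ of labelled rules $r$ with finite antecedent set $A(r)$, consequent $C(r)$ and kind strict ($\to$), defeasible ($\Rightarrow$) or defeater ($\leadsto$), and an acyclic superiority relation $>$ on labels. $D$ is function-free if no rule or fact contains a function symbol other than constants; range-restricted if every fact is variable-free and every variable in the consequent of a rule also occurs in its antecedent; hierarchical if there is a mapping $m$ from predicates to non-negative integers (with $p(\dots)$ and $\neg p(\dots)$ both mapped to $m(p)$) such that for every rule the consequent is mapped to a greater value than every antecedent literal; locally hierarchical if the set of ground instances of $D$ is hierarchical when each ground atom is treated as a proposition. Compiled program. For a literal $q$ with predicate $p$, $\mathtt{q}$ denotes $\mathtt{p}$ if $q$ is positive and $\mathtt{not\_p}$ if negative; $\mathtt{{\sim}q}$ is the name of the complement; predicate names are formed by concatenation; rule labels are constants. $S_D$ consists exactly of: (i) for each fact $q(\vec a)$: unit clauses $\mathtt{definitely\_q}(\vec a)$, $\mathtt{lambda\_q}(\vec a)$, $\mathtt{defeasibly\_q}(\vec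 a)$; (ii) for each strict rule $r:q_1(\vec a_1),\dots,q_n(\vec a_n)\to q(\vec a)$: $\mathtt{definitely\_q}(\vec a)\,\text{:- }\,\mathtt{body}^\Delta_r(\vec a)$, $\mathtt{lambda\_q}(\vec a)\,\text{:- }\,\mathtt{body}^\Delta_r(\vec a)$, $\mathtt{defeasibly\_q}(\vec a)\,\text{:- }\,\mathtt{body}^\Delta_r(\vec a)$, $\mathtt{body}^\Delta_r(\vec a)\,\text{:- }\,\mathtt{definitely\_q_1}(\vec a_1),\dots,\mathtt{definitely\_q_n}(\vec a_n)$; (iii) for each strict or defeasible rule $r:q_1(\vec a_1),\dots,q_n(\vec a_n)\hookrightarrow q(\vec a)$: $\mathtt{lambda\_q}(\vec a)\,\text{:- }\,not\ \mathtt{definitely\_{\sim}q}(\vec a),\mathtt{body}^\lambda_r(\vec a)$ and $\mathtt{defeasibly\_q}(\vec a)\,\text{:- }\,not\ \mathtt{definitely\_{\sim}q}(\vec a),\mathtt{body}^d_r(\vec a),not\ \mathtt{overruled\_q}(\vec a)$; (iv) for each rule $s$ of any kind, $s:q_1(\vec a_1),\dots,q_n(\vec a_n)\hookrightarrow q(\vec a)$: $\mathtt{body}^\lambda_s(\vec a)\,\text{:- }\,\mathtt{lambda\_q_1}(\vec a_1),\dots,\mathtt{lambda\_q_n}(\vec a_n)$, $\mathtt{body}^d_s(\vec a)\,\text{:- }\,\mathtt{defeasibly\_q_1}(\vec a_1),\dots,\mathtt{defeasibly\_q_n}(\vec a_n)$, $\mathtt{overruled\_{\sim}q}(\vec a)\,\text{:-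 }\,\mathtt{body}^\lambda_s(\vec a),not\ \mathtt{defeated\_q}(s,\vec a)$; (v) for each strict or defeasible rule $t$ with consequent $q(\vec a)$ and each rule $s$ with consequent of the form ${\sim}q(\dots)$ with $t>s$: $\mathtt{defeated\_{\sim}q}(s,\vec a)\,\text{:- }\,\mathtt{body}^d_t(\vec a)$. Logic programs. A Datalog$^\neg$ program is one whose only terms are constants and variables. A program is range-restricted if every variable in the head of a clause appears in a positive body literal, and safe if every variable in a clause appears in a positive body literal of that clause. For predicates, $p\sqsupseteq_{+1}q$ ($p\sqsupseteq_{ -1}q$) if some clause has head predicate $p$ and a positive (negative) body literal with predicate $q$; $\geq_{+1},\geq_{ -1}$ are the least relations with $p\geq_{+1}p$ and ($p\sqsupseteq_i q$ and $q\geq_j r$ imply $p\geq_{i\cdot j}r$). A program is call-consistent if no predicate $p$ has $p\geq_{ -1}p$. A program is stratified if there is a mapping $m$ from predicates to non-negative integers such that for every clause $m(\text{head})\geq m(B)$ for each positive body literal $B$ and $m(\text{head})>m(C)$ for each negative body literal $not\ C$; it is locally stratified if the set of its ground instances is stratified when each ground atom is treated as a propositional predicate. -}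

module Defs where

open import Data.Nat using (ℕ; _≤_; _<_)
open import Data.Bool using (Bool; true; false; not)
open import Data.List using (List; []; _∷_; map)
open import Data.List.Relation.Unary.All using (All)
open import Data.List.Relation.Unary.Any using (Any)
open import Data.List.Membership.Propositional using (_∈_)
open import Data.List.Relation.Unary.Unique.Propositional using (Unique)
open import Data.Product using (_×_; _,_; Σ; ∃)
open import Relation.Nullary using (¬_)
open import Relation.Binary.PropositionalEquality using (_≡_)

-- Symbols (all drawn from ℕ; the four kinds live in separate namespaces)

Var : Set
Var = ℕ

FunSym : Set      -- function symbols; a constant is a 0-ary function symbol
FunSym = ℕ

PredSym : Set
PredSym = ℕ

Label : Set
Label = ℕ

data Term : Set where
  var : Var → Term
  app : FunSym → List Term → Term

const : FunSym → Term
const c = app c []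

data _occursIn_ (x : Var) : Term → Set where
  here  : x occursIn var x
  inArg : ∀ {f ts} → Any (x occursIn_) ts → x occursIn app f ts

data ConstOrVar : Term → Set where
  isVar   : ∀ x → ConstOrVar (var x)
  isConst : ∀ c → ConstOrVar (app c [])

data Ground : Term → Set where
  gapp : ∀ {f ts} → All Ground ts → Ground (app f ts)

Subst : Set
Subst = Var → Term

mutual
  _⟦_⟧ : Term → Subst → Term
  var x ⟦ σ ⟧ = σ x
  app f ts ⟦ σ ⟧ = app f (substs ts σ)

  substs : List Term → Subst → List Term
  substs [] σ = []
  substs (t ∷ ts) σ = (t ⟦ σ ⟧) ∷ substs ts σ

GroundSubst : Subst → Set
GroundSubst σ = ∀ x → Ground (σ x)

record Literal : Set where
  constructor lit
  field
    positive : Bool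
    pred     : PredSym
    args     : List Term
open Literal public

-- the "name" of a literal's predicate: p or not_p
LName : Set
LName = Bool × PredSym

lname : Literal → LName
lname q = positive q , pred q

compName : LName → LName
compName (b , p) = not b , p

∼_ : Literal → Literal
∼ q = lit (not (positive q)) (pred q) (args q)

_∈varsL_ : Var → Literal → Set
x ∈varsL q = Any (x occursIn_) (args q)

data Kind : Set where
  strict defeasible defeater : Kind

data StrictOrDefeasible : Kind → Set where
  isStrict     : StrictOrDefeasible strict
  isDefeasible : StrictOrDefeasible defeasible

record Rule : Set where
  constructor rule
  field
    label : Label
    kind  : Kind
    ante  : List Literal
    cons  : Literal
open Rule public

record Theory : Set where
  constructor theory
  field
    facts : List Literal
    rules : List Rule
    sup   : List (Label × Label)    -- (t , s) ∈ sup  means  t > s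
open Theory public

data _⊢_>⁺_ (D : Theory) : Label → Label → Set where
  one  : ∀ {a b} → (a , b) ∈ sup D → D ⊢ a >⁺ b
  more : ∀ {a b c} → (a , b) ∈ sup D → D ⊢ b >⁺ c → D ⊢ a >⁺ c

IsTheory : Theory → Set
IsTheory D = Unique (map label (rules D)) × (∀ a → ¬ (D ⊢ a >⁺ a))

LitPropT : (Literal → Set) → Theory → Set
LitPropT P D = All P (facts D) × All (λ r → All P (ante r) × P (cons r)) (rules D)

FunctionFreeT : Theory → Set
FunctionFreeT = LitPropT (λ q → All ConstOrVar (args q))

VarFreeLit : Literal → Set
VarFreeLit q = ∀ x → ¬ (x ∈varsL q)

VariableFreeT : Theory → Set
VariableFreeT = LitPropT VarFreeLit

RangeRestrictedT : Theory → Set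
RangeRestrictedT D =
  All VarFreeLit (facts D) ×
  All (λ r → ∀ x → x ∈varsL cons r → Any (x ∈varsL_) (ante r)) (rules D)

-- p(…) and ¬p(…) are both mapped to m p
HierarchicalT : Theory → Set
HierarchicalT D = Σ (PredSym → ℕ) λ m →
  All (λ r → All (λ a → m (pred a) < m (pred (cons r))) (ante r)) (rules D)

-- ground atoms are (predicate , ground argument list); polarity ignored.
-- The ground instances of the rules of D must be hierarchical.
LocallyHierarchicalT : Theory → Set
LocallyHierarchicalT D = Σ (PredSym → List Term → ℕ) λ m →
  All (λ r → ∀ σ → GroundSubst σ →
         All (λ a → m (pred a) (substs (args a) σ)
                    < m (pred (cons r)) (substs (args (cons r)) σ)) (ante r))
      (rules D)

-- predicates of the compiled program; e.g.  definitely (true , p)  is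
-- definitely_p  and  definitely (false , p)  is  definitely_not_p
data PPred : Set where
  definitely lambda defeasibly overruled defeated : LName → PPred
  bodyΔ bodyλ bodyd : Label → PPred

infix 30 _⟨_⟩
record Atom : Set where
  constructor _⟨_⟩
  field
    ppred : PPred
    pargs : List Term
open Atom public

data BodyLit : Set where
  pos : Atom → BodyLit
  neg : Atom → BodyLit

infix 10 _:-_
record Clause : Set where
  constructor _:-_
  field
    head : Atom
    body : List BodyLit
open Clause public

Program : Set₁
Program = Clause → Set

bodyAtom : BodyLit → Atom
bodyAtom (pos a) = a
bodyAtom (neg a) = a

posAtoms : List BodyLit → List Atom
posAtoms [] = []
posAtoms (pos a ∷ bs) = a ∷ posAtoms bs
posAtoms (neg a ∷ bs) = posAtoms bs

atomsOf : Clause → List Atom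
atomsOf c = head c ∷ map bodyAtom (body c)

_∈vars_ : Var → Atom → Set
x ∈vars a = Any (x occursIn_) (pargs a)

IsDatalog : Program → Set
IsDatalog P = ∀ c → P c → All (λ a → All ConstOrVar (pargs a)) (atomsOf c)

VariableFreeP : Program → Set
VariableFreeP P = ∀ c → P c → ∀ x → ¬ Any (x ∈vars_) (atomsOf c)

RangeRestrictedP : Program → Set
RangeRestrictedP P = ∀ c → P c → ∀ x → x ∈vars head c → Any (x ∈vars_) (posAtoms (body c))

SafeP : Program → Set
SafeP P = ∀ c → P c → ∀ x → Any (x ∈vars_) (atomsOf c) → Any (x ∈vars_) (posAtoms (body c))

data Sign : Set where
  plus minus : Sign

_·_ : Sign → Sign → Sign
plus  · j = j
minus · plus = minus
minus · minus = plus

signOf : BodyLit → Sign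
signOf (pos _) = plus
signOf (neg _) = minus

Dep : Program → PPred → Sign → PPred → Set
Dep P p i q = Σ Clause λ c → P c × ppred (head c) ≡ p ×
  Any (λ b → signOf b ≡ i × ppred (bodyAtom b) ≡ q) (body c)

data Geq (P : Program) : PPred → Sign → PPred → Set where
  geq-refl : ∀ {p} → Geq P p plus p
  geq-step : ∀ {p q r i j} → Dep P p i q → Geq P q j r → Geq P p (i · j) r

CallConsistent : Program → Set
CallConsistent P = ∀ p → ¬ Geq P p minus p

RespectsStrata : (Atom → ℕ) → Atom → BodyLit → Set
RespectsStrata m h (pos b) = m b ≤ m h
RespectsStrata m h (neg b) = m b < m h

Stratified : Program → Set
Stratified P = Σ (PPred → ℕ) λ m → ∀ c → P c →
  All (RespectsStrata (λ a → m (ppred a)) (head c)) (body c)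

substAtom : Atom → Subst → Atom
substAtom (p ⟨ ts ⟩) σ = p ⟨ substs ts σ ⟩

substBL : BodyLit → Subst → BodyLit
substBL (pos a) σ = pos (substAtom a σ)
substBL (neg a) σ = neg (substAtom a σ)

-- ground atoms treated as propositions: m assigns a level to every
-- (ground) atom; only ground instances of clauses are constrained
LocallyStratified : Program → Set
LocallyStratified P = Σ (Atom → ℕ) λ m → ∀ c → P c → ∀ σ → GroundSubst σ →
  All (λ b → RespectsStrata m (substAtom (head c) σ) (substBL b σ)) (body c)

at : (LName → PPred) → Literal → Atom
at X q = X (lname q) ⟨ args q ⟩

labTerm : Label → Term
labTerm l = app l []

bodyAt : (Label → PPred) → Rule → Atom
bodyAt B r = B (label r) ⟨ args (cons r) ⟩

data Compiled (D : Theory) : Clause → Set where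
  fact-definitely : ∀ {q} → q ∈ facts D → Compiled D (at definitely q :- [])
  fact-lambda     : ∀ {q} → q ∈ facts D → Compiled D (at lambda q :- [])
  fact-defeasibly : ∀ {q} → q ∈ facts D → Compiled D (at defeasibly q :- [])
  strict-definitely : ∀ {r} → r ∈ rules D → kind r ≡ strict →
    Compiled D (at definitely (cons r) :- (pos (bodyAt bodyΔ r) ∷ []))
  strict-lambda : ∀ {r} → r ∈ rules D → kind r ≡ strict →
    Compiled D (at lambda (cons r) :- (pos (bodyAt bodyΔ r) ∷ []))
  strict-defeasibly : ∀ {r} → r ∈ rules D → kind r ≡ strict →
    Compiled D (at defeasibly (cons r) :- (pos (bodyAt bodyΔ r) ∷ []))
  strict-body : ∀ {r} → r ∈ rules D → kind r ≡ strict →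
    Compiled D (bodyAt bodyΔ r :- map (λ a → pos (at definitely a)) (ante r))
  sd-lambda : ∀ {r} → r ∈ rules D → StrictOrDefeasible (kind r) →
    Compiled D (at lambda (cons r) :-
      (neg (at definitely (∼ cons r)) ∷ pos (bodyAt bodyλ r) ∷ []))
  sd-defeasibly : ∀ {r} → r ∈ rules D → StrictOrDefeasible (kind r) →
    Compiled D (at defeasibly (cons r) :-
      (neg (at definitely (∼ cons r)) ∷ pos (bodyAt bodyd r) ∷
       neg (at overruled (cons r)) ∷ []))
  any-bodyλ : ∀ {s} → s ∈ rules D →
    Compiled D (bodyAt bodyλ s :- map (λ a → pos (at lambda a)) (ante s))
  any-bodyd : ∀ {s} → s ∈ rules D →
    Compiled D (bodyAt bodyd s :- map (λ a → pos (at defeasibly a)) (ante s))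
  any-overruled : ∀ {s} → s ∈ rules D →
    Compiled D (at overruled (∼ cons s) :-
      (pos (bodyAt bodyλ s) ∷
       neg (defeated (lname (cons s)) ⟨ labTerm (label s) ∷ args (cons s) ⟩) ∷ []))
  sup-defeated : ∀ {t s} → t ∈ rules D → StrictOrDefeasible (kind t) →
    s ∈ rules D → lname (cons s) ≡ compName (lname (cons t)) →
    (label t , label s) ∈ sup D →
    Compiled D (defeated (lname (∼ cons t)) ⟨ labTerm (label s) ∷ args (cons t) ⟩
                :- (pos (bodyAt bodyd t) ∷ []))

-- Every atom of S_D is X(a⃗) or defeated(s, a⃗) for a literal q(a⃗) occurring in D and a
-- rule label s, which is a constant, so being function-free or variable-free transfers
-- between D and S_D literal by literal. A head variable of a clause of S_D lies in a
-- positive body atom unless the clause comes from a non-ground fact or from a rule whose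
-- consequent has a variable missing from its antecedent; every negative body atom shares
-- the head's arguments up to a label, so safety coincides with range-restriction. For call-consistency,
-- every dependency either descends through the layers definitely < lambda < defeasibly or
-- stays in a layer, where its sign is the quotient of parities assigned to predicates.
-- For (local) stratification, an atom built from a literal of (ground) level k gets rank
-- 4k + offset, the offsets ordering the clauses generated for one literal; antecedents
-- sit a full level lower.
module Submission where

open import Defs
open import Data.Empty using (⊥-elim)
open import Data.List using (List; []; _∷_; map; drop)
open import Data.List.Membership.Propositional using (_∈_; lose)
open import Data.List.Membership.Propositional.Properties using (∈-map⁺)
open import Data.List.Relation.Unary.All as All using (All; []; _∷_; lookup; tabulate)
open import Data.List.Relation.Unary.All.Properties as AllP using (All¬⇒¬Any)
open import Data.List.Relation.Unary.Any using (Any; here; there; satisfied)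
open import Data.List.Relation.Unary.Any.Properties as AnyP using ()
open import Data.List.Relation.Unary.AllPairs using ([]; _∷_)
open import Data.List.Relation.Unary.Unique.Propositional using (Unique)
open import Data.Nat using (ℕ; suc; _+_; _*_; _≤_; _<_; z<s; s<s; _≟_)
open import Data.Nat.Properties
  using (≤-reflexive; <⇒≤; <-trans; <-≤-trans; ≤-<-trans; <-irrefl;
         m≤n+m; +-monoˡ-<; *-monoʳ-≤; *-suc; module ≤-Reasoning)
open import Data.Product using (_×_; _,_; proj₁; proj₂; ∃)
open import Data.Sum using (_⊎_; inj₁; inj₂)
open import Function using (_∘_)
open import Function.Bundles using (_⇔_; mk⇔; Equivalence)
import Function.Properties.Equivalence as ⇔
open import Relation.Nullary using (¬_; yes; no)
open import Relation.Binary.PropositionalEquality using (_≡_; _≢_; refl; sym; trans; cong)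

module CompiledArgs (D : Theory) {Q : List Term → Set}
                    (Q-label : ∀ l ts → Q ts → Q (labTerm l ∷ ts)) where

  AllCompiledArgs : Set
  AllCompiledArgs = ∀ c → Compiled D c → All (Q ∘ pargs) (atomsOf c)

  compiled⇒theory : AllCompiledArgs → LitPropT (Q ∘ args) D
  compiled⇒theory h =
      tabulate (λ mem → All.head (h _ (fact-definitely mem)))
    , tabulate (λ mem → let atoms = h _ (any-bodyλ mem) in
                        AllP.map⁻ (AllP.map⁻ (All.tail atoms)) , All.head atoms)

  theory⇒compiled : LitPropT (Q ∘ args) D → AllCompiledArgs
  theory⇒compiled (facts✓ , rules✓) _ = atoms
    where
    cons✓ : ∀ {r} → r ∈ rules D → Q (args (cons r))
    cons✓ mem = proj₂ (lookup rules✓ mem)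

    ante✓ : ∀ {r} → r ∈ rules D → (X : LName → PPred) →
            All (Q ∘ pargs) (map bodyAtom (map (λ a → pos (at X a)) (ante r)))
    ante✓ mem X = AllP.map⁺ (AllP.map⁺ (proj₁ (lookup rules✓ mem)))

    atoms : ∀ {c} → Compiled D c → All (Q ∘ pargs) (atomsOf c)
    atoms (fact-definitely mem) = lookup facts✓ mem ∷ []
    atoms (fact-lambda mem) = lookup facts✓ mem ∷ []
    atoms (fact-defeasibly mem) = lookup facts✓ mem ∷ []
    atoms (strict-definitely mem _) = cons✓ mem ∷ cons✓ mem ∷ []
    atoms (strict-lambda mem _) = cons✓ mem ∷ cons✓ mem ∷ []
    atoms (strict-defeasibly mem _) = cons✓ mem ∷ cons✓ mem ∷ []
    atoms (strict-body mem _) = cons✓ mem ∷ ante✓ mem definitely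
    atoms (sd-lambda mem _) = cons✓ mem ∷ cons✓ mem ∷ cons✓ mem ∷ []
    atoms (sd-defeasibly mem _) = cons✓ mem ∷ cons✓ mem ∷ cons✓ mem ∷ cons✓ mem ∷ []
    atoms (any-bodyλ mem) = cons✓ mem ∷ ante✓ mem lambda
    atoms (any-bodyd mem) = cons✓ mem ∷ ante✓ mem defeasibly
    atoms (any-overruled {s} mem) =
      cons✓ mem ∷ cons✓ mem ∷ Q-label (label s) _ (cons✓ mem) ∷ []
    atoms (sup-defeated {s = s} mem _ _ _ _) =
      Q-label (label s) _ (cons✓ mem) ∷ cons✓ mem ∷ []

  compiled⇔theory : AllCompiledArgs ⇔ LitPropT (Q ∘ args) D
  compiled⇔theory = mk⇔ compiled⇒theory theory⇒compiled

datalog⇔function-free : (D : Theory) → IsDatalog (Compiled D) ⇔ FunctionFreeT D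
datalog⇔function-free D = CompiledArgs.compiled⇔theory D (λ l _ → isConst l ∷_)

VarFreeArgs : List Term → Set
VarFreeArgs ts = ∀ x → ¬ Any (x occursIn_) ts

varFree-label : ∀ l ts → VarFreeArgs ts → VarFreeArgs (labTerm l ∷ ts)
varFree-label l ts vf x (here (inArg ()))
varFree-label l ts vf x (there occ) = vf x occ

variableFreeP⇔allVarFree : (P : Program) →
  VariableFreeP P ⇔ (∀ c → P c → All (VarFreeArgs ∘ pargs) (atomsOf c))
variableFreeP⇔allVarFree P = mk⇔
  (λ vf c k → tabulate (λ mem x occ → vf c k x (lose mem occ)))
  (λ vf c k x → All¬⇒¬Any (All.map (λ vfa → vfa x) (vf c k)))

variable-free⇔ : (D : Theory) → VariableFreeP (Compiled D) ⇔ VariableFreeT D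
variable-free⇔ D = ⇔.trans (variableFreeP⇔allVarFree (Compiled D))
                            (CompiledArgs.compiled⇔theory D varFree-label)

posAtoms-map-pos : ∀ {A : Set} (f : A → Atom) xs →
  posAtoms (map (λ a → pos (f a)) xs) ≡ map f xs
posAtoms-map-pos f [] = refl
posAtoms-map-pos f (x ∷ xs) = cong (f x ∷_) (posAtoms-map-pos f xs)

vars-positive-antecedents : ∀ {x} (X : LName → PPred) qs →
  Any (x ∈vars_) (posAtoms (map (λ a → pos (at X a)) qs)) ⇔ Any (x ∈varsL_) qs
vars-positive-antecedents X qs rewrite posAtoms-map-pos (at X) qs = mk⇔ AnyP.map⁻ AnyP.map⁺

positive-body : ∀ {A : Set} {P : Atom → Set} (f : A → Atom) xs →
  Any P (map bodyAtom (map (λ a → pos (f a)) xs)) →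
  Any P (posAtoms (map (λ a → pos (f a)) xs))
positive-body f xs h rewrite posAtoms-map-pos f xs = AnyP.map⁺ (AnyP.map⁻ (AnyP.map⁻ h))

BodyVarsCovered : Program → Set
BodyVarsCovered P = ∀ c → P c → ∀ x → Any (x ∈vars_) (map bodyAtom (body c)) →
                    x ∈vars head c ⊎ Any (x ∈vars_) (posAtoms (body c))

safe⇒range-restricted : (P : Program) → SafeP P → RangeRestrictedP P
safe⇒range-restricted P safe c k x h = safe c k x (here h)

range-restricted⇒safe : (P : Program) → BodyVarsCovered P → RangeRestrictedP P → SafeP P
range-restricted⇒safe P covered rr c k x (here h) = rr c k x h
range-restricted⇒safe P covered rr c k x (there h) with covered c k x h
... | inj₁ inHead = rr c k x inHead
... | inj₂ inPositive = inPositive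

compiled-body-vars-covered : (D : Theory) → BodyVarsCovered (Compiled D)
compiled-body-vars-covered D _ k x = covered k
  where
  covered : ∀ {c} → Compiled D c → Any (x ∈vars_) (map bodyAtom (body c)) →
            x ∈vars head c ⊎ Any (x ∈vars_) (posAtoms (body c))
  covered (strict-definitely _ _) (here h) = inj₂ (here h)
  covered (strict-lambda _ _) (here h) = inj₂ (here h)
  covered (strict-defeasibly _ _) (here h) = inj₂ (here h)
  covered (strict-body {r} _ _) h = inj₂ (positive-body (at definitely) (ante r) h)
  covered (sd-lambda _ _) (here h) = inj₁ h
  covered (sd-lambda _ _) (there (here h)) = inj₂ (here h)
  covered (sd-defeasibly _ _) (here h) = inj₁ h
  covered (sd-defeasibly _ _) (there (here h)) = inj₂ (here h)
  covered (sd-defeasibly _ _) (there (there (here h))) = inj₁ h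
  covered (any-bodyλ {r} _) h = inj₂ (positive-body (at lambda) (ante r) h)
  covered (any-bodyd {r} _) h = inj₂ (positive-body (at defeasibly) (ante r) h)
  covered (any-overruled _) (here h) = inj₂ (here h)
  covered (any-overruled _) (there (here (here (inArg ()))))
  covered (any-overruled _) (there (here (there h))) = inj₁ h
  covered (sup-defeated _ _ _ _ _) (here h) = inj₂ (here h)

range-restrictedP⇒T : (D : Theory) → RangeRestrictedP (Compiled D) → RangeRestrictedT D
range-restrictedP⇒T D rr =
    tabulate (λ mem x h → noPositiveAtom (rr _ (fact-definitely mem) x h))
  , tabulate (λ {r} mem x h →
      Equivalence.to (vars-positive-antecedents lambda (ante r)) (rr _ (any-bodyλ mem) x h))
  where
  noPositiveAtom : ∀ {x} → ¬ Any (x ∈vars_) []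
  noPositiveAtom ()

range-restrictedT⇒P : (D : Theory) → RangeRestrictedT D → RangeRestrictedP (Compiled D)
range-restrictedT⇒P D (facts✓ , rules✓) _ k x = inPositive k
  where
  fromAntecedents : ∀ {r} → r ∈ rules D → (X : LName → PPred) → x ∈varsL cons r →
                    Any (x ∈vars_) (posAtoms (map (λ a → pos (at X a)) (ante r)))
  fromAntecedents {r} mem X h =
    Equivalence.from (vars-positive-antecedents X (ante r)) (lookup rules✓ mem x h)

  inPositive : ∀ {c} → Compiled D c → x ∈vars head c → Any (x ∈vars_) (posAtoms (body c))
  inPositive (fact-definitely mem) h = ⊥-elim (lookup facts✓ mem x h)
  inPositive (fact-lambda mem) h = ⊥-elim (lookup facts✓ mem x h)
  inPositive (fact-defeasibly mem) h = ⊥-elim (lookup facts✓ mem x h)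
  inPositive (strict-definitely _ _) h = here h
  inPositive (strict-lambda _ _) h = here h
  inPositive (strict-defeasibly _ _) h = here h
  inPositive (strict-body mem _) h = fromAntecedents mem definitely h
  inPositive (sd-lambda _ _) h = here h
  inPositive (sd-defeasibly _ _) h = here h
  inPositive (any-bodyλ mem) h = fromAntecedents mem lambda h
  inPositive (any-bodyd mem) h = fromAntecedents mem defeasibly h
  inPositive (any-overruled _) h = here h
  inPositive (sup-defeated _ _ _ _ _) (here (inArg ()))
  inPositive (sup-defeated _ _ _ _ _) (there h) = here h

range-restricted⇔ : (D : Theory) → RangeRestrictedP (Compiled D) ⇔ RangeRestrictedT D
range-restricted⇔ D = mk⇔ (range-restrictedP⇒T D) (range-restrictedT⇒P D)

safe⇔range-restricted : (D : Theory) → SafeP (Compiled D) ⇔ RangeRestrictedT D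
safe⇔range-restricted D = mk⇔
  (range-restrictedP⇒T D ∘ safe⇒range-restricted (Compiled D))
  (range-restricted⇒safe (Compiled D) (compiled-body-vars-covered D) ∘ range-restrictedT⇒P D)

·-assoc : ∀ i j k → i · (j · k) ≡ (i · j) · k
·-assoc plus j k = refl
·-assoc minus plus k = refl
·-assoc minus minus plus = refl
·-assoc minus minus minus = refl

minus·s≢s : ∀ s → minus · s ≢ s
minus·s≢s plus ()
minus·s≢s minus ()

module Layering (layer : PPred → ℕ) (parity : PPred → Sign) where

  Descends : PPred → Sign → PPred → Set
  Descends p i q = layer q < layer p ⊎ (layer q ≡ layer p × parity p ≡ i · parity q)

  descends-refl : ∀ {p} → Descends p plus p
  descends-refl = inj₂ (refl , refl)

  descends-trans : ∀ {p q r i j} → Descends p i q → Descends q j r → Descends p (i · j) r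
  descends-trans (inj₁ q<p) (inj₁ r<q) = inj₁ (<-trans r<q q<p)
  descends-trans (inj₁ q<p) (inj₂ (r≡q , _)) = inj₁ (≤-<-trans (≤-reflexive r≡q) q<p)
  descends-trans (inj₂ (q≡p , _)) (inj₁ r<q) = inj₁ (<-≤-trans r<q (≤-reflexive q≡p))
  descends-trans {i = i} {j} (inj₂ (q≡p , p≡iq)) (inj₂ (r≡q , q≡jr)) =
    inj₂ (trans r≡q q≡p , trans p≡iq (trans (cong (i ·_) q≡jr) (·-assoc i j _)))

  geq-descends : (P : Program) → (∀ {p i q} → Dep P p i q → Descends p i q) →
                 ∀ {p j r} → Geq P p j r → Descends p j r
  geq-descends P dep-descends geq-refl = descends-refl
  geq-descends P dep-descends (geq-step d g) =
    descends-trans (dep-descends d) (geq-descends P dep-descends g)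

  call-consistent-by-layers : (P : Program) → (∀ {p i q} → Dep P p i q → Descends p i q) →
                              CallConsistent P
  call-consistent-by-layers P dep-descends p p≥₋p with geq-descends P dep-descends p≥₋p
  ... | inj₁ p<p = <-irrefl refl p<p
  ... | inj₂ (_ , p≡-p) = minus·s≢s (parity p) (sym p≡-p)

layer : PPred → ℕ
layer (definitely _) = 0
layer (bodyΔ _) = 0
layer (lambda _) = 1
layer (bodyλ _) = 1
layer (defeasibly _) = 2
layer (bodyd _) = 2
layer (overruled _) = 2
layer (defeated _) = 2

-- Inside a layer the negative dependencies are exactly those into and out of overruled.
parity : PPred → Sign
parity (overruled _) = minus
parity _ = plus

open Layering layer parity

compiled-descends : (D : Theory) → ∀ {p i q} → Dep (Compiled D) p i q → Descends p i q
compiled-descends D (_ , k , refl , dep) = descends k dep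
  where
  antecedent-dependency : ∀ {i q} (X : LName → PPred) qs →
    Any (λ b → signOf b ≡ i × ppred (bodyAtom b) ≡ q) (map (λ a → pos (at X a)) qs) →
    i ≡ plus × ∃ λ n → q ≡ X n
  antecedent-dependency X qs dep with satisfied (AnyP.map⁻ dep)
  ... | a , refl , refl = refl , lname a , refl

  descends : ∀ {c i q} → Compiled D c →
    Any (λ b → signOf b ≡ i × ppred (bodyAtom b) ≡ q) (body c) → Descends (ppred (head c)) i q
  descends (strict-definitely _ _) (here (refl , refl)) = inj₂ (refl , refl)
  descends (strict-lambda _ _) (here (refl , refl)) = inj₁ z<s
  descends (strict-defeasibly _ _) (here (refl , refl)) = inj₁ z<s
  descends (strict-body {r} _ _) dep with antecedent-dependency definitely (ante r) dep
  ... | refl , _ , refl = inj₂ (refl , refl)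
  descends (sd-lambda _ _) (here (refl , refl)) = inj₁ z<s
  descends (sd-lambda _ _) (there (here (refl , refl))) = inj₂ (refl , refl)
  descends (sd-defeasibly _ _) (here (refl , refl)) = inj₁ z<s
  descends (sd-defeasibly _ _) (there (here (refl , refl))) = inj₂ (refl , refl)
  descends (sd-defeasibly _ _) (there (there (here (refl , refl)))) = inj₂ (refl , refl)
  descends (any-bodyλ {r} _) dep with antecedent-dependency lambda (ante r) dep
  ... | refl , _ , refl = inj₂ (refl , refl)
  descends (any-bodyd {r} _) dep with antecedent-dependency defeasibly (ante r) dep
  ... | refl , _ , refl = inj₂ (refl , refl)
  descends (any-overruled _) (here (refl , refl)) = inj₁ (s<s z<s)
  descends (any-overruled _) (there (here (refl , refl))) = inj₂ (refl , refl)
  descends (sup-defeated _ _ _ _ _) (here (refl , refl)) = inj₂ (refl , refl)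

compiled-call-consistent : (D : Theory) → CallConsistent (Compiled D)
compiled-call-consistent D = call-consistent-by-layers (Compiled D) (compiled-descends D)

-- Junk value 0 for a label of no rule.
consequentPred : List Rule → Label → PredSym
consequentPred [] l = 0
consequentPred (r ∷ rs) l with label r ≟ l
... | yes _ = pred (cons r)
... | no _ = consequentPred rs l

consequentPred-label : ∀ {rs r} → Unique (map label rs) → r ∈ rs →
                       consequentPred rs (label r) ≡ pred (cons r)
consequentPred-label {r ∷ _} _ (here refl) with label r ≟ label r
... | yes _ = refl
... | no l≢l = ⊥-elim (l≢l refl)
consequentPred-label {r′ ∷ _} {r} (r′∉ ∷ unique) (there mem) with label r′ ≟ label r
... | yes r′≡r = ⊥-elim (lookup r′∉ (∈-map⁺ label mem) r′≡r)
... | no _ = consequentPred-label unique mem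

scaled-gap : ∀ k {i a c} → i < k → a < c → i + k * a < k * c
scaled-gap k {i} {a} {c} i<k a<c = begin-strict
  i + k * a   <⟨ +-monoˡ-< (k * a) i<k ⟩
  k + k * a   ≡⟨ sym (*-suc k a) ⟩
  k * suc a   ≤⟨ *-monoʳ-≤ k a<c ⟩
  k * c       ∎
  where open ≤-Reasoning

stratified-by-predicate-ranks : (P : Program) (rank : PPred → ℕ) →
  (∀ c → P c → ∀ σ → GroundSubst σ →
     All (λ b → RespectsStrata (rank ∘ ppred) (substAtom (head c) σ) (substBL b σ)) (body c)) →
  Stratified P
stratified-by-predicate-ranks P rank local =
  rank , λ c k → All.map unsubst (local c k (λ _ → const 0) (λ _ → gapp []))
  where
  unsubst : ∀ {h b σ} → RespectsStrata (rank ∘ ppred) (substAtom h σ) (substBL b σ) →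
            RespectsStrata (rank ∘ ppred) h b
  unsubst {b = pos _} le = le
  unsubst {b = neg _} lt = lt

module CompiledStrata {D : Theory} (unique : Unique (map label (rules D)))
  (m : PredSym → List Term → ℕ)
  (hierarchy : All (λ r → ∀ σ → GroundSubst σ →
                 All (λ a → m (pred a) (substs (args a) σ)
                            < m (pred (cons r)) (substs (args (cons r)) σ)) (ante r))
               (rules D)) where

  offset : PPred → ℕ
  offset (bodyΔ _) = 0
  offset (bodyλ _) = 0
  offset (bodyd _) = 0
  offset (definitely _) = 1
  offset (defeated _) = 1
  offset (lambda _) = 2
  offset (overruled _) = 2
  offset (defeasibly _) = 3

  offset<4 : ∀ X → offset X < 4
  offset<4 (bodyΔ _) = z<s
  offset<4 (bodyλ _) = z<s
  offset<4 (bodyd _) = z<s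
  offset<4 (definitely _) = s<s z<s
  offset<4 (defeated _) = s<s z<s
  offset<4 (lambda _) = s<s (s<s z<s)
  offset<4 (overruled _) = s<s (s<s z<s)
  offset<4 (defeasibly _) = s<s (s<s (s<s z<s))

  predOf : PPred → PredSym
  predOf (definitely n) = proj₂ n
  predOf (lambda n) = proj₂ n
  predOf (defeasibly n) = proj₂ n
  predOf (overruled n) = proj₂ n
  predOf (defeated n) = proj₂ n
  predOf (bodyΔ l) = consequentPred (rules D) l
  predOf (bodyλ l) = consequentPred (rules D) l
  predOf (bodyd l) = consequentPred (rules D) l

  -- The first argument of defeated_q(s, a⃗) is the rule label s.
  literalArgs : PPred → List Term → List Term
  literalArgs (defeated _) ts = drop 1 ts
  literalArgs _ ts = ts

  stratum : Atom → ℕ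
  stratum (X ⟨ ts ⟩) = offset X + 4 * m (predOf X) (literalArgs X ts)

  RanksLiterals : (LName → PPred) → Set
  RanksLiterals X = ∀ n ts → stratum (X n ⟨ ts ⟩) ≡ offset (X n) + 4 * m (proj₂ n) ts

  body≤ : ∀ {r} → r ∈ rules D → ∀ ts i →
          4 * m (consequentPred (rules D) (label r)) ts ≤ i + 4 * m (pred (cons r)) ts
  body≤ mem ts i rewrite consequentPred-label unique mem = m≤n+m _ i

  antecedents≤body : ∀ {r} → r ∈ rules D → ∀ {X} → RanksLiterals X → ∀ σ → GroundSubst σ →
    All (λ a → stratum (substAtom (at X a) σ)
               ≤ 4 * m (consequentPred (rules D) (label r)) (substs (args (cons r)) σ))
        (ante r)
  antecedents≤body {r} mem {X} ranks σ ground rewrite consequentPred-label unique mem =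
    All.map below (lookup hierarchy mem σ ground)
    where
    open ≤-Reasoning
    below : ∀ {a} →
      m (pred a) (substs (args a) σ) < m (pred (cons r)) (substs (args (cons r)) σ) →
            stratum (substAtom (at X a) σ) ≤ 4 * m (pred (cons r)) (substs (args (cons r)) σ)
    below {a} a<r = begin
      stratum (substAtom (at X a) σ)
        ≡⟨ ranks (lname a) _ ⟩
      offset (X (lname a)) + 4 * m (pred a) (substs (args a) σ)
        ≤⟨ <⇒≤ (scaled-gap 4 (offset<4 (X (lname a))) a<r) ⟩
      4 * m (pred (cons r)) (substs (args (cons r)) σ) ∎

  compiled-locally-stratified : ∀ c → Compiled D c → ∀ σ → GroundSubst σ →
    All (λ b → RespectsStrata stratum (substAtom (head c) σ) (substBL b σ)) (body c)
  compiled-locally-stratified _ k σ ground = respects k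
    where
    level : Rule → ℕ
    level r = 4 * m (pred (cons r)) (substs (args (cons r)) σ)

    offset-mono : ∀ r {i j} → i < j → i + level r < j + level r
    offset-mono r = +-monoˡ-< (level r)

    antecedents : ∀ {r} → r ∈ rules D → (X : LName → PPred) → RanksLiterals X →
      All (λ a → stratum (substAtom (at X a) σ)
                 ≤ 4 * m (consequentPred (rules D) (label r)) (substs (args (cons r)) σ))
          (ante r)
    antecedents mem X ranks = antecedents≤body mem {X} ranks σ ground

    respects : ∀ {c} → Compiled D c →
      All (λ b → RespectsStrata stratum (substAtom (head c) σ) (substBL b σ)) (body c)
    respects (fact-definitely _) = []
    respects (fact-lambda _) = []
    respects (fact-defeasibly _) = []
    respects (strict-definitely mem _) = body≤ mem _ 1 ∷ []
    respects (strict-lambda mem _) = body≤ mem _ 2 ∷ []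
    respects (strict-defeasibly mem _) = body≤ mem _ 3 ∷ []
    respects (strict-body mem _) = AllP.map⁺ (antecedents mem definitely (λ _ _ → refl))
    respects (sd-lambda {r} mem _) = offset-mono r {1} {2} (s<s z<s) ∷ body≤ mem _ 2 ∷ []
    respects (sd-defeasibly {r} mem _) =
        offset-mono r {1} {3} (s<s z<s)
      ∷ body≤ mem _ 3
      ∷ offset-mono r {2} {3} (s<s (s<s z<s))
      ∷ []
    respects (any-bodyλ mem) = AllP.map⁺ (antecedents mem lambda (λ _ _ → refl))
    respects (any-bodyd mem) = AllP.map⁺ (antecedents mem defeasibly (λ _ _ → refl))
    respects (any-overruled {s} mem) = body≤ mem _ 2 ∷ offset-mono s {1} {2} (s<s z<s) ∷ []
    respects (sup-defeated mem _ _ _ _) = body≤ mem _ 1 ∷ []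

locally-hierarchical⇒locally-stratified : (D : Theory) → IsTheory D →
  LocallyHierarchicalT D → LocallyStratified (Compiled D)
locally-hierarchical⇒locally-stratified D (unique , _) (m , hierarchy) =
  stratum , compiled-locally-stratified
  where open CompiledStrata unique m hierarchy

hierarchical⇒stratified : (D : Theory) → IsTheory D →
  HierarchicalT D → Stratified (Compiled D)
hierarchical⇒stratified D (unique , _) (m , hierarchy) =
  stratified-by-predicate-ranks (Compiled D) (λ X → stratum (X ⟨ [] ⟩))
    compiled-locally-stratified
  where open CompiledStrata unique (λ p _ → m p) (All.map (λ below _ _ → below) hierarchy)

theorem7 : (D : Theory) → IsTheory D →
    (IsDatalog (Compiled D) ⇔ FunctionFreeT D) ×
    (VariableFreeP (Compiled D) ⇔ VariableFreeT D) ×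
    (RangeRestrictedP (Compiled D) ⇔ RangeRestrictedT D) ×
    (SafeP (Compiled D) ⇔ RangeRestrictedT D) ×
    CallConsistent (Compiled D) ×
    (HierarchicalT D → Stratified (Compiled D)) ×
    (LocallyHierarchicalT D → LocallyStratified (Compiled D))
theorem7 D isTheory =
    datalog⇔function-free D
  , variable-free⇔ D
  , range-restricted⇔ D
  , safe⇔range-restricted D
  , compiled-call-consistent D
  , hierarchical⇒stratified D isTheory
  , locally-hierarchical⇒locally-stratified D isTheory
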